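{- Let $n\ge0$ and $k\ge1$ be integers. The map from $\mathrm{PV}^{2,2k-1}_{2n+1}$ to $\mathrm{Alt}^{\le k}_{2n+1}$ given by \[ (a_1,\dots,a_{2n+1})\mapsto\left(k-\lfloor a_1/2\rfloor,\dots,k-\lfloor a_{2n+1}/2\rfloor\right) \] is a bijection.
   Context: An $\ell$-peak-valley sequence is a sequence $(a_1,\dots,a_N)$ of nonnegative integers such that, setting $a_0=a_{N+1}=0$, for each $i=1,\dots,N$: if $a_i\equiv0\pmod\ell$ then $a_{i-1}>a_i<a_{i+1}$ (valley), and if $a_i\equiv-1\pmod\ell$ then $a_{i-1}<a_i>a_{i+1}$ (peak). $\mathrm{PV}^{\ell,K}_N$ is the set of such sequences of length $N$ with $0\le a_i\le K$ for all $i$. $\mathrm{Alt}^{\le k}_N$ is the set of integer sequences $(b_1,\dots,b_N)$ with $b_1\le b_2\ge b_3\le b_4\ge\cdots$ and $1\le b_i\le k$ for all $i$. -}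

module Defs where

open import Data.Nat using (ℕ; zero; suc; _+_; _*_; _∸_; _≤_; _≥_; _<_; _>_; NonZero)
open import Data.Nat.DivMod using (_/_; _%_)
open import Data.Vec using (Vec; []; _∷_; map)
open import Data.Product using (_×_)
open import Relation.Binary.PropositionalEquality using (_≡_)

get : ∀ {N} → Vec ℕ N → ℕ → ℕ
get []       _       = 0
get (x ∷ xs) zero    = x
get (x ∷ xs) (suc i) = get xs i

-- 1-based entry a_i, with the padding convention a_0 = a_{N+1} = 0
at : ∀ {N} → Vec ℕ N → ℕ → ℕ
at v zero    = 0
at v (suc i) = get v i

IsPV : (ℓ : ℕ) .{{_ : NonZero ℓ}} → (K N : ℕ) → Vec ℕ N → Set
IsPV ℓ K N a =
  ∀ i → 1 ≤ i → i ≤ N →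
    (at a i ≤ K)
    × (at a i % ℓ ≡ 0 → at a (i ∸ 1) > at a i × at a i < at a (suc i))
    × (at a i % ℓ ≡ ℓ ∸ 1 → at a (i ∸ 1) < at a i × at a i > at a (suc i))

IsAlt : (k N : ℕ) → Vec ℕ N → Set
IsAlt k N b =
  (∀ i → 1 ≤ i → i ≤ N → 1 ≤ at b i × at b i ≤ k)
  × (∀ i → 1 ≤ i → i < N →
       (i % 2 ≡ 1 → at b i ≤ at b (suc i))
       × (i % 2 ≡ 0 → at b i ≥ at b (suc i)))

φ : (k : ℕ) → ∀ {N} → Vec ℕ N → Vec ℕ N
φ k = map (λ x → k ∸ (x / 2))

{-# OPTIONS --safe #-}
-- In a 2-peak-valley sequence the even entries are valleys and the odd ones peaks, so two
-- neighbours never share a parity; as a_0 = 0 forces a_1 to be odd, a_i ≡ i (mod 2). Hence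
-- a_i = (i mod 2) + 2 c_i with c_i = ⌊a_i/2⌋ < k, and every peak/valley inequality compares an
-- even entry 2c with an odd one 2d + 1, which holds exactly when c ≤ d. So the conditions on a
-- become c_1 ≥ c_2 ≤ c_3 ≥ ⋯, i.e. b_i = k - c_i is alternating. Only the ends need care: as N
-- is odd, a_1 and a_N are odd, hence peaks over a_0 = a_{N+1} = 0.
module Submission where

open import Defs
open import Data.Nat using (ℕ; zero; suc; _+_; _*_; _∸_; _≤_; _≥_; _<_; _>_; z≤n; s≤s; s≤s⁻¹; z<s; NonZero)
open import Data.Nat.Properties
open import Data.Nat.DivMod using (_/_; _%_; m≡m%n+[m/n]*n; m%n<n; [m+kn]%n≡m%n; m%n%n≡m%n; m*n/n≡m; +-distrib-/; m<n*o⇒m/o<n)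
open import Data.Vec using (Vec; []; _∷_; map)
open import Data.Product using (_×_; ∃; _,_; proj₁; proj₂)
open import Data.Sum using (_⊎_; inj₁; inj₂)
open import Function.Bundles using (_⇔_; mk⇔; Equivalence)
open import Relation.Nullary using (contradiction)
open import Relation.Binary.PropositionalEquality

%2≡0⊎%2≡1 : ∀ m → m % 2 ≡ 0 ⊎ m % 2 ≡ 1
%2≡0⊎%2≡1 zero          = inj₁ refl
%2≡0⊎%2≡1 (suc zero)    = inj₂ refl
%2≡0⊎%2≡1 (suc (suc m)) = %2≡0⊎%2≡1 m

even⇒suc-odd : ∀ m → m % 2 ≡ 0 → suc m % 2 ≡ 1
even⇒suc-odd zero          _ = refl
even⇒suc-odd (suc (suc m)) e = even⇒suc-odd m e

odd⇒suc-even : ∀ m → m % 2 ≡ 1 → suc m % 2 ≡ 0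
odd⇒suc-even (suc zero)    _ = refl
odd⇒suc-even (suc (suc m)) o = odd⇒suc-even m o

suc-even⇒odd : ∀ m → suc m % 2 ≡ 0 → m % 2 ≡ 1
suc-even⇒odd (suc zero)    _ = refl
suc-even⇒odd (suc (suc m)) e = suc-even⇒odd m e

suc-odd⇒even : ∀ m → suc m % 2 ≡ 1 → m % 2 ≡ 0
suc-odd⇒even zero          _ = refl
suc-odd⇒even (suc (suc m)) o = suc-odd⇒even m o

[2n+1]%2≡1 : ∀ n → (2 * n + 1) % 2 ≡ 1
[2n+1]%2≡1 n = trans (cong (_% 2) (trans (+-comm (2 * n) 1) (cong suc (*-comm 2 n)))) ([m+kn]%n≡m%n 1 n 2)

2*[1+k]∸1≡1+k*2 : ∀ k → 2 * suc k ∸ 1 ≡ suc (k * 2)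
2*[1+k]∸1≡1+k*2 k = cong (_∸ 1) (*-comm 2 (suc k))

m≤2k∸1⇒m/2<k : ∀ {m} k .{{_ : NonZero k}} → m ≤ 2 * k ∸ 1 → m / 2 < k
m≤2k∸1⇒m/2<k {m} (suc k) m≤ = m<n*o⇒m/o<n (s≤s (subst (m ≤_) (2*[1+k]∸1≡1+k*2 k) m≤))

withParity : ℕ → ℕ → ℕ
withParity i c = i % 2 + c * 2

withParity-%2 : ∀ i c → withParity i c % 2 ≡ i % 2
withParity-%2 i c = trans ([m+kn]%n≡m%n (i % 2) c 2) (m%n%n≡m%n i 2)

withParity-/2 : ∀ i c → withParity i c / 2 ≡ c
withParity-/2 i c with %2≡0⊎%2≡1 i
... | inj₁ e rewrite e = m*n/n≡m c 2
... | inj₂ o rewrite o = trans (+-distrib-/ 1 (c * 2) 1+[c*2%2]<2) (m*n/n≡m c 2)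
  where
  1+[c*2%2]<2 : 1 + c * 2 % 2 < 2
  1+[c*2%2]<2 = subst (λ r → 1 + r < 2) (sym ([m+kn]%n≡m%n 0 c 2)) (s≤s (s≤s z≤n))

withParity-even : ∀ {i} c → i % 2 ≡ 0 → withParity i c ≡ c * 2
withParity-even c e = cong (_+ c * 2) e

withParity-odd : ∀ {i} c → i % 2 ≡ 1 → withParity i c ≡ suc (c * 2)
withParity-odd c o = cong (_+ c * 2) o

withParity-<⇔≤ : ∀ i i′ {c d} → i % 2 ≡ 0 → i′ % 2 ≡ 1 → withParity i c < withParity i′ d ⇔ c ≤ d
withParity-<⇔≤ i i′ {c} {d} e o = mk⇔
  (λ lt → *-cancelʳ-≤ c d 2 (s≤s⁻¹ (subst₂ _<_ (withParity-even {i} c e) (withParity-odd {i′} d o) lt)))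
  (λ c≤d → subst₂ _<_ (sym (withParity-even {i} c e)) (sym (withParity-odd {i′} d o)) (s≤s (*-monoˡ-≤ 2 c≤d)))

withParity-≤2k∸1 : ∀ i {c k} → c < k → withParity i c ≤ 2 * k ∸ 1
withParity-≤2k∸1 i {c} {suc k} (s≤s c≤k) =
  subst (withParity i c ≤_) (sym (2*[1+k]∸1≡1+k*2 k)) (+-mono-≤ (s≤s⁻¹ (m%n<n i 2)) (*-monoˡ-≤ 2 c≤k))

get-map : ∀ {N} (f : ℕ → ℕ) (v : Vec ℕ N) {j} → j < N → get (map f v) j ≡ f (get v j)
get-map f (x ∷ v) {zero}  _       = refl
get-map f (x ∷ v) {suc j} (s≤s h) = get-map f v h

get-beyond : ∀ {N} (v : Vec ℕ N) {j} → N ≤ j → get v j ≡ 0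
get-beyond []      _       = refl
get-beyond (x ∷ v) (s≤s h) = get-beyond v h

get-ext : ∀ {N} {v w : Vec ℕ N} → (∀ j → j < N → get v j ≡ get w j) → v ≡ w
get-ext {v = []}    {[]}    _  = refl
get-ext {v = x ∷ v} {y ∷ w} eq = cong₂ _∷_ (eq 0 z<s) (get-ext (λ j h → eq (suc j) (s≤s h)))

mapWithPositionFrom : ℕ → (ℕ → ℕ → ℕ) → ∀ {N} → Vec ℕ N → Vec ℕ N
mapWithPositionFrom i f []       = []
mapWithPositionFrom i f (x ∷ xs) = f i x ∷ mapWithPositionFrom (suc i) f xs

get-mapWithPositionFrom : ∀ {N} i f (v : Vec ℕ N) {j} → j < N →
                          get (mapWithPositionFrom i f v) j ≡ f (i + j) (get v j)
get-mapWithPositionFrom i f (x ∷ v) {zero}  _       = cong (λ p → f p x) (sym (+-identityʳ i))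
get-mapWithPositionFrom i f (x ∷ v) {suc j} (s≤s h) =
  trans (get-mapWithPositionFrom (suc i) f v h) (cong (λ p → f p (get v j)) (sym (+-suc i j)))

at-φ : ∀ {N} k (a : Vec ℕ N) {j} → suc j ≤ N → at (φ k a) (suc j) ≡ k ∸ at a (suc j) / 2
at-φ k a = get-map (λ x → k ∸ x / 2) a

unφ : ℕ → ∀ {N} → Vec ℕ N → Vec ℕ N
unφ k = mapWithPositionFrom 1 (λ i x → withParity i (k ∸ x))

at-unφ : ∀ {N} k (b : Vec ℕ N) {j} → suc j ≤ N → at (unφ k b) (suc j) ≡ withParity (suc j) (k ∸ at b (suc j))
at-unφ k b = get-mapWithPositionFrom 1 (λ i x → withParity i (k ∸ x)) b

module _ {N K : ℕ} {a : Vec ℕ N} (pv : IsPV 2 K N a) where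

  pv-bound : ∀ {j} → suc j ≤ N → at a (suc j) ≤ K
  pv-bound h = proj₁ (pv _ (s≤s z≤n) h)

  pv-valley : ∀ {j} → suc j ≤ N → at a (suc j) % 2 ≡ 0 → at a j > at a (suc j) × at a (suc j) < at a (suc (suc j))
  pv-valley h = proj₁ (proj₂ (pv _ (s≤s z≤n) h))

  pv-peak : ∀ {j} → suc j ≤ N → at a (suc j) % 2 ≡ 1 → at a j < at a (suc j) × at a (suc j) > at a (suc (suc j))
  pv-peak h = proj₂ (proj₂ (pv _ (s≤s z≤n) h))

  -- Two adjacent valleys (or peaks) would each lie below (above) the other.
  pv-parity : ∀ {j} → suc j ≤ N → at a (suc j) % 2 ≡ suc j % 2
  pv-parity {zero} h with %2≡0⊎%2≡1 (at a 1)
  ... | inj₁ e = contradiction (proj₁ (pv-valley h e)) n≮0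
  ... | inj₂ o = o
  pv-parity {suc j} h with %2≡0⊎%2≡1 (at a (suc j)) | %2≡0⊎%2≡1 (at a (suc (suc j)))
  ... | inj₁ e | inj₁ e′ = contradiction (proj₂ (pv-valley (<⇒≤ h) e)) (<-asym (proj₁ (pv-valley h e′)))
  ... | inj₂ o | inj₂ o′ = contradiction (proj₂ (pv-peak (<⇒≤ h) o)) (<-asym (proj₁ (pv-peak h o′)))
  ... | inj₁ e | inj₂ o′ = trans o′ (sym (even⇒suc-odd (suc j) (trans (sym (pv-parity (<⇒≤ h))) e)))
  ... | inj₂ o | inj₁ e′ = trans e′ (sym (odd⇒suc-even (suc j) (trans (sym (pv-parity (<⇒≤ h))) o)))

  pv-withParity : ∀ {j} → suc j ≤ N → at a (suc j) ≡ withParity (suc j) (at a (suc j) / 2)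
  pv-withParity {j} h = trans (m≡m%n+[m/n]*n (at a (suc j)) 2) (cong (_+ at a (suc j) / 2 * 2) (pv-parity h))

  pv-<⇒/2≤ : ∀ {j j′} → suc j ≤ N → suc j′ ≤ N → suc j % 2 ≡ 0 → suc j′ % 2 ≡ 1 →
             at a (suc j) < at a (suc j′) → at a (suc j) / 2 ≤ at a (suc j′) / 2
  pv-<⇒/2≤ {j} {j′} h h′ e o lt =
    Equivalence.to (withParity-<⇔≤ (suc j) (suc j′) e o) (subst₂ _<_ (pv-withParity h) (pv-withParity h′) lt)

pv-/2<k : ∀ {N} k .{{_ : NonZero k}} {a : Vec ℕ N} → IsPV 2 (2 * k ∸ 1) N a →
          ∀ {j} → suc j ≤ N → at a (suc j) / 2 < k
pv-/2<k k pv h = m≤2k∸1⇒m/2<k k (pv-bound pv h)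

pv⇒alt-φ : ∀ {N} k .{{_ : NonZero k}} {a : Vec ℕ N} → IsPV 2 (2 * k ∸ 1) N a → IsAlt k N (φ k a)
pv⇒alt-φ {N} k {a} pv = bounds , alternation
  where
  bounds : ∀ i → 1 ≤ i → i ≤ N → 1 ≤ at (φ k a) i × at (φ k a) i ≤ k
  bounds (suc j) _ h rewrite at-φ k a h = m<n⇒0<n∸m (pv-/2<k k pv h) , m∸n≤m k (at a (suc j) / 2)

  alternation : ∀ i → 1 ≤ i → i < N →
                (i % 2 ≡ 1 → at (φ k a) i ≤ at (φ k a) (suc i)) × (i % 2 ≡ 0 → at (φ k a) i ≥ at (φ k a) (suc i))
  alternation (suc j) _ h rewrite at-φ k a (<⇒≤ h) | at-φ k a h =
      (λ o → ∸-monoʳ-≤ k (pv-<⇒/2≤ pv h (<⇒≤ h) (odd⇒suc-even (suc j) o) o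
                           (proj₂ (pv-peak pv (<⇒≤ h) (trans (pv-parity pv (<⇒≤ h)) o)))))
    , (λ e → ∸-monoʳ-≤ k (pv-<⇒/2≤ pv (<⇒≤ h) h e (even⇒suc-odd (suc j) e)
                           (proj₂ (pv-valley pv (<⇒≤ h) (trans (pv-parity pv (<⇒≤ h)) e)))))

unφ-φ : ∀ {N} k .{{_ : NonZero k}} {a : Vec ℕ N} → IsPV 2 (2 * k ∸ 1) N a → unφ k (φ k a) ≡ a
unφ-φ k {a} pv = get-ext λ j h → begin
  at (unφ k (φ k a)) (suc j)                      ≡⟨ at-unφ k (φ k a) h ⟩
  withParity (suc j) (k ∸ at (φ k a) (suc j))     ≡⟨ cong (λ x → withParity (suc j) (k ∸ x)) (at-φ k a h) ⟩
  withParity (suc j) (k ∸ (k ∸ at a (suc j) / 2)) ≡⟨ cong (withParity (suc j)) (m∸[m∸n]≡n (<⇒≤ (pv-/2<k k pv h))) ⟩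
  withParity (suc j) (at a (suc j) / 2)           ≡⟨ pv-withParity pv h ⟨
  at a (suc j)                                    ∎
  where open ≡-Reasoning

φ-unφ : ∀ {N} k {b : Vec ℕ N} → (∀ {j} → suc j ≤ N → at b (suc j) ≤ k) → φ k (unφ k b) ≡ b
φ-unφ k {b} b≤k = get-ext λ j h → begin
  at (φ k (unφ k b)) (suc j)                    ≡⟨ at-φ k (unφ k b) h ⟩
  k ∸ at (unφ k b) (suc j) / 2                  ≡⟨ cong (λ x → k ∸ x / 2) (at-unφ k b h) ⟩
  k ∸ withParity (suc j) (k ∸ at b (suc j)) / 2 ≡⟨ cong (k ∸_) (withParity-/2 (suc j) (k ∸ at b (suc j))) ⟩
  k ∸ (k ∸ at b (suc j))                        ≡⟨ m∸[m∸n]≡n (b≤k h) ⟩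
  at b (suc j)                                  ∎
  where open ≡-Reasoning

module _ {N k : ℕ} .{{_ : NonZero k}} {b : Vec ℕ N} (alt : IsAlt k N b) where

  alt-≤k : ∀ {j} → suc j ≤ N → at b (suc j) ≤ k
  alt-≤k h = proj₂ (proj₁ alt _ (s≤s z≤n) h)

  private
    a : Vec ℕ N
    a = unφ k b

    c : ℕ → ℕ
    c i = k ∸ at b i

    1≤b : ∀ {j} → suc j ≤ N → 1 ≤ at b (suc j)
    1≤b h = proj₁ (proj₁ alt _ (s≤s z≤n) h)

    alt-odd : ∀ {j} → suc j < N → suc j % 2 ≡ 1 → at b (suc j) ≤ at b (suc (suc j))
    alt-odd h = proj₁ (proj₂ alt _ (s≤s z≤n) h)

    alt-even : ∀ {j} → suc j < N → suc j % 2 ≡ 0 → at b (suc (suc j)) ≤ at b (suc j)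
    alt-even h = proj₂ (proj₂ alt _ (s≤s z≤n) h)

    c<k : ∀ {j} → suc j ≤ N → c (suc j) < k
    c<k h = ∸-monoʳ-< (1≤b h) (alt-≤k h)

    ≥⇒< : ∀ {j j′} → suc j ≤ N → suc j′ ≤ N → suc j % 2 ≡ 0 → suc j′ % 2 ≡ 1 →
          at b (suc j′) ≤ at b (suc j) → at a (suc j) < at a (suc j′)
    ≥⇒< {j} {j′} h h′ e o b′≤b = subst₂ _<_ (sym (at-unφ k b h)) (sym (at-unφ k b h′))
      (Equivalence.from (withParity-<⇔≤ (suc j) (suc j′) e o) (∸-monoʳ-≤ k b′≤b))

    0<odd : ∀ {j} → suc j ≤ N → suc j % 2 ≡ 1 → 0 < at a (suc j)
    0<odd {j} h o = subst (0 <_) (sym (trans (at-unφ k b h) (withParity-odd {suc j} (c (suc j)) o))) z<s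

  unφ-parity : ∀ {j} → suc j ≤ N → at (unφ k b) (suc j) % 2 ≡ suc j % 2
  unφ-parity {j} h = trans (cong (_% 2) (at-unφ k b h)) (withParity-%2 (suc j) (c (suc j)))

  unφ-bound : ∀ {j} → suc j ≤ N → at (unφ k b) (suc j) ≤ 2 * k ∸ 1
  unφ-bound {j} h = subst (_≤ 2 * k ∸ 1) (sym (at-unφ k b h)) (withParity-≤2k∸1 (suc j) (c<k h))

  -- An even position is neither 1 nor N, since N is odd.
  unφ-valley : N % 2 ≡ 1 → ∀ {j} → suc j ≤ N → suc j % 2 ≡ 0 →
               at (unφ k b) j > at (unφ k b) (suc j) × at (unφ k b) (suc j) < at (unφ k b) (suc (suc j))
  unφ-valley N-odd {suc j} h e =
      ≥⇒< h (<⇒≤ h) e (suc-even⇒odd (suc j) e) (alt-odd h (suc-even⇒odd (suc j) e))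
    , ≥⇒< h h< e (even⇒suc-odd (suc (suc j)) e) (alt-even h< e)
    where
    h< : suc (suc j) < N
    h< = ≤∧≢⇒< h (λ j≡N → contradiction (trans (trans (sym e) (cong (_% 2) j≡N)) N-odd) λ ())

  unφ-peak : ∀ {j} → suc j ≤ N → suc j % 2 ≡ 1 →
             at (unφ k b) j < at (unφ k b) (suc j) × at (unφ k b) (suc j) > at (unφ k b) (suc (suc j))
  unφ-peak {j} h o = left j h o , right (m≤n⇒m<n∨m≡n h)
    where
    left : ∀ j → suc j ≤ N → suc j % 2 ≡ 1 → at a j < at a (suc j)
    left zero    h o = 0<odd h o
    left (suc j) h o = ≥⇒< (<⇒≤ h) h (suc-odd⇒even (suc j) o) o (alt-even h (suc-odd⇒even (suc j) o))
    right : suc j < N ⊎ suc j ≡ N → at a (suc (suc j)) < at a (suc j)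
    right (inj₁ h<) = ≥⇒< h< h (odd⇒suc-even (suc j) o) o (alt-odd h< o)
    right (inj₂ j≡N) = subst (_< at a (suc j)) (sym (get-beyond a (≤-reflexive (sym j≡N)))) (0<odd h o)

alt⇒pv-unφ : ∀ {N} k .{{_ : NonZero k}} {b : Vec ℕ N} → N % 2 ≡ 1 → IsAlt k N b → IsPV 2 (2 * k ∸ 1) N (unφ k b)
alt⇒pv-unφ k N-odd alt (suc j) _ h =
    unφ-bound alt h
  , (λ e → unφ-valley alt N-odd h (trans (sym (unφ-parity alt h)) e))
  , (λ o → unφ-peak alt h (trans (sym (unφ-parity alt h)) o))

proposition3p3 : (n k : ℕ) → 1 ≤ k →
    ((a : Vec ℕ (2 * n + 1)) → IsPV 2 (2 * k ∸ 1) (2 * n + 1) a → IsAlt k (2 * n + 1) (φ k a))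
    × ((a a′ : Vec ℕ (2 * n + 1)) → IsPV 2 (2 * k ∸ 1) (2 * n + 1) a → IsPV 2 (2 * k ∸ 1) (2 * n + 1) a′ → φ k a ≡ φ k a′ → a ≡ a′)
    × ((b : Vec ℕ (2 * n + 1)) → IsAlt k (2 * n + 1) b → ∃ λ a → IsPV 2 (2 * k ∸ 1) (2 * n + 1) a × φ k a ≡ b)
proposition3p3 n k@(suc _) _ =
    (λ a → pv⇒alt-φ k)
  , (λ a a′ pv pv′ φa≡φa′ → begin
       a              ≡⟨ unφ-φ k pv ⟨
       unφ k (φ k a)  ≡⟨ cong (unφ k) φa≡φa′ ⟩
       unφ k (φ k a′) ≡⟨ unφ-φ k pv′ ⟩
       a′             ∎)
  , (λ b alt → unφ k b , alt⇒pv-unφ k ([2n+1]%2≡1 n) alt , φ-unφ k (alt-≤k alt))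
  where open ≡-Reasoning
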